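{- Let $\Sigma_4=\{0,1,2,3\}$, let $\alpha\in\Sigma_4^*$ and let $w=1\alpha3\alpha2$. Then either $w$ contains a square, or $w$ contains an occurrence of one of the subwords $12$, $13$, $21$, $32$, $231$, $10302$.
   Context: A square is a nonempty word of the form $xx$; "contains" refers to contiguous subwords. -}

module Defs where

open import Data.Fin using (Fin; zero; suc)
open import Data.List using (List; []; _∷_; _++_)
open import Data.Product using (∃-syntax; _×_)
open import Relation.Binary.PropositionalEquality using (_≡_)

Σ₄ : Set
Σ₄ = Fin 4

c0 c1 c2 c3 : Σ₄
c0 = zero
c1 = suc zero
c2 = suc (suc zero)
c3 = suc (suc (suc zero))

Word : Set
Word = List Σ₄

_⊑_ : Word → Word → Set
u ⊑ w = ∃[ p ] ∃[ s ] (w ≡ p ++ u ++ s)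

NonEmpty : Word → Set
NonEmpty x = ∃[ a ] ∃[ y ] (x ≡ a ∷ y)

ContainsSquare : Word → Set
ContainsSquare w = ∃[ x ] (NonEmpty x × (x ++ x) ⊑ w)

wordOf : Word → Word
wordOf α = (c1 ∷ []) ++ α ++ (c3 ∷ []) ++ α ++ (c2 ∷ [])

-- Only the first three letters a b c and the last three letters x y z of α
-- matter: the factors 1abc, xyz3abc and xyz2 of 1α3α2 already contain a square
-- or a forbidden word, as an exhaustive check over the 4⁶ choices confirms.
-- Words α of length less than three are checked directly.
module Submission where

open import Defs
open import Data.Fin.Properties using (all?) renaming (_≟_ to _≟ᶠ_)
open import Data.List using (List; []; _∷_; _++_; concatMap; inits; tails)
open import Data.List.Properties using (++-assoc)
open import Data.List.Relation.Binary.Infix.Heterogeneous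
  using (Infix; MkView; toView; fromView)
open import Data.List.Relation.Binary.Infix.Heterogeneous.Properties using (infix?)
open import Data.List.Relation.Binary.Pointwise using (Pointwise-≡⇒≡; ≡⇒Pointwise-≡)
open import Data.List.Relation.Unary.Any using (Any; any?; satisfied)
open import Data.Product using (_,_; _×_; ∃-syntax)
open import Data.Sum using (_⊎_; [_,_]′)
import Data.Sum as Sum
open import Function using (_∘_)
open import Relation.Binary.Definitions using (Decidable)
open import Relation.Binary.PropositionalEquality
  using (_≡_; refl; sym; cong; cong₂; module ≡-Reasoning)
open import Relation.Nullary using (Dec; yes; no; map′; _×-dec_; _⊎-dec_)
open import Relation.Nullary.Decidable using (from-yes)

open ≡-Reasoning

HasForbiddenFactor : Word → Set
HasForbiddenFactor w =
    ((c1 ∷ c2 ∷ []) ⊑ w)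
  ⊎ ((c1 ∷ c3 ∷ []) ⊑ w)
  ⊎ ((c2 ∷ c1 ∷ []) ⊑ w)
  ⊎ ((c3 ∷ c2 ∷ []) ⊑ w)
  ⊎ ((c2 ∷ c3 ∷ c1 ∷ []) ⊑ w)
  ⊎ ((c1 ∷ c0 ∷ c3 ∷ c0 ∷ c2 ∷ []) ⊑ w)

SquareOrForbidden : Word → Set
SquareOrForbidden w = ContainsSquare w ⊎ HasForbiddenFactor w

⊑-trans : ∀ {u v w} → u ⊑ v → v ⊑ w → u ⊑ w
⊑-trans {u} (p , s , refl) (p′ , s′ , refl) = p′ ++ p , s ++ s′ , (begin
  p′ ++ (p ++ u ++ s) ++ s′   ≡⟨ cong (p′ ++_) (++-assoc p (u ++ s) s′) ⟩
  p′ ++ p ++ (u ++ s) ++ s′   ≡⟨ cong (λ t → p′ ++ p ++ t) (++-assoc u s s′) ⟩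
  p′ ++ p ++ u ++ s ++ s′     ≡⟨ ++-assoc p′ p (u ++ s ++ s′) ⟨
  (p′ ++ p) ++ u ++ s ++ s′   ∎)

containsSquare-⊑ : ∀ {u w} → u ⊑ w → ContainsSquare u → ContainsSquare w
containsSquare-⊑ u⊑w (x , x≢[] , xx⊑u) = x , x≢[] , ⊑-trans xx⊑u u⊑w

squareOrForbidden-⊑ : ∀ {u w} → u ⊑ w → SquareOrForbidden u → SquareOrForbidden w
squareOrForbidden-⊑ u⊑w =
  Sum.map (containsSquare-⊑ u⊑w)
    (Sum.map lift (Sum.map lift (Sum.map lift (Sum.map lift (Sum.map lift lift)))))
  where
  lift : ∀ {v} → v ⊑ _ → v ⊑ _
  lift v⊑u = ⊑-trans v⊑u u⊑w

infix 4 _⊑?_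

_⊑?_ : Decidable _⊑_
u ⊑? w = map′ infix⇒⊑ ⊑⇒infix (infix? _≟ᶠ_ u w)
  where
  infix⇒⊑ : ∀ {u w} → Infix _≡_ u w → u ⊑ w
  infix⇒⊑ i with MkView p u≈v s ← toView i =
    p , s , cong (λ v → p ++ v ++ s) (sym (Pointwise-≡⇒≡ u≈v))

  ⊑⇒infix : ∀ {u w} → u ⊑ w → Infix _≡_ u w
  ⊑⇒infix (p , s , refl) = fromView (MkView p (≡⇒Pointwise-≡ refl) s)

nonEmpty? : (x : Word) → Dec (NonEmpty x)
nonEmpty? []      = no λ ()
nonEmpty? (a ∷ y) = yes (a , y , refl)

factors : Word → List Word
factors = concatMap inits ∘ tails

-- A decidable strengthening of SquareOrForbidden: the root of the square is
-- looked for among the factors of w.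
Detected : Word → Set
Detected w = Any (λ x → NonEmpty x × (x ++ x) ⊑ w) (factors w) ⊎ HasForbiddenFactor w

detected? : (w : Word) → Dec (Detected w)
detected? w = any? (λ x → nonEmpty? x ×-dec x ++ x ⊑? w) (factors w) ⊎-dec forbidden?
  where
  forbidden? : Dec (HasForbiddenFactor w)
  forbidden? = _ ⊑? w ⊎-dec _ ⊑? w ⊎-dec _ ⊑? w ⊎-dec _ ⊑? w ⊎-dec _ ⊑? w ⊎-dec _ ⊑? w

detected⇒squareOrForbidden : ∀ {w} → Detected w → SquareOrForbidden w
detected⇒squareOrForbidden = Sum.map₁ satisfied

windowsDetected : ∀ a b c x y z →
    Detected (c1 ∷ a ∷ b ∷ c ∷ [])
  ⊎ Detected (x ∷ y ∷ z ∷ c3 ∷ a ∷ b ∷ c ∷ [])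
  ⊎ Detected (x ∷ y ∷ z ∷ c2 ∷ [])
windowsDetected = from-yes
  (all? λ a → all? λ b → all? λ c → all? λ x → all? λ y → all? λ z →
       detected? (c1 ∷ a ∷ b ∷ c ∷ [])
     ⊎-dec detected? (x ∷ y ∷ z ∷ c3 ∷ a ∷ b ∷ c ∷ [])
     ⊎-dec detected? (x ∷ y ∷ z ∷ c2 ∷ []))

prefixWindow-⊑ : ∀ {α} pre β → α ≡ pre ++ β → (c1 ∷ pre) ⊑ wordOf α
prefixWindow-⊑ pre β refl =
  [] , β ++ c3 ∷ (pre ++ β) ++ c2 ∷ [] , cong (c1 ∷_) (++-assoc pre β _)

middleWindow-⊑ : ∀ {α} γ suf pre β → α ≡ γ ++ suf → α ≡ pre ++ β →
                 (suf ++ c3 ∷ pre) ⊑ wordOf α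
middleWindow-⊑ {α} γ suf pre β α≡γsuf α≡preβ = c1 ∷ γ , β ++ c2 ∷ [] , cong (c1 ∷_) (begin
  α ++ c3 ∷ α ++ c2 ∷ []                     ≡⟨ cong₂ (λ u v → u ++ c3 ∷ v ++ c2 ∷ []) α≡γsuf α≡preβ ⟩
  (γ ++ suf) ++ c3 ∷ (pre ++ β) ++ c2 ∷ []   ≡⟨ ++-assoc γ suf _ ⟩
  γ ++ suf ++ c3 ∷ (pre ++ β) ++ c2 ∷ []     ≡⟨ cong (λ t → γ ++ suf ++ c3 ∷ t) (++-assoc pre β _) ⟩
  γ ++ suf ++ (c3 ∷ pre) ++ β ++ c2 ∷ []     ≡⟨ cong (γ ++_) (++-assoc suf (c3 ∷ pre) _) ⟨
  γ ++ (suf ++ c3 ∷ pre) ++ β ++ c2 ∷ []     ∎)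

suffixWindow-⊑ : ∀ {α} γ suf → α ≡ γ ++ suf → (suf ++ c2 ∷ []) ⊑ wordOf α
suffixWindow-⊑ {α} γ suf α≡γsuf = c1 ∷ α ++ c3 ∷ γ , [] , cong (c1 ∷_) (begin
  α ++ c3 ∷ α ++ c2 ∷ []                     ≡⟨ cong (λ t → α ++ c3 ∷ t ++ c2 ∷ []) α≡γsuf ⟩
  α ++ c3 ∷ (γ ++ suf) ++ c2 ∷ []            ≡⟨ cong (λ t → α ++ c3 ∷ t) (++-assoc γ suf _) ⟩
  α ++ (c3 ∷ γ) ++ suf ++ c2 ∷ []            ≡⟨ ++-assoc α (c3 ∷ γ) _ ⟨
  (α ++ c3 ∷ γ) ++ suf ++ c2 ∷ []            ≡⟨ cong (λ t → (α ++ c3 ∷ γ) ++ t) (++-assoc suf (c2 ∷ []) []) ⟨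
  (α ++ c3 ∷ γ) ++ (suf ++ c2 ∷ []) ++ []    ∎)

lastThree : ∀ (a b c : Σ₄) β → ∃[ γ ] ∃[ x ] ∃[ y ] ∃[ z ] (a ∷ b ∷ c ∷ β ≡ γ ++ x ∷ y ∷ z ∷ [])
lastThree a b c []      = [] , a , b , c , refl
lastThree a b c (d ∷ β) with γ , x , y , z , e ← lastThree b c d β = a ∷ γ , x , y , z , cong (a ∷_) e

lemma5 : (α : Word) →
    ContainsSquare (wordOf α)
    ⊎ ((c1 ∷ c2 ∷ []) ⊑ wordOf α)
    ⊎ ((c1 ∷ c3 ∷ []) ⊑ wordOf α)
    ⊎ ((c2 ∷ c1 ∷ []) ⊑ wordOf α)
    ⊎ ((c3 ∷ c2 ∷ []) ⊑ wordOf α)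
    ⊎ ((c2 ∷ c3 ∷ c1 ∷ []) ⊑ wordOf α)
    ⊎ ((c1 ∷ c0 ∷ c3 ∷ c0 ∷ c2 ∷ []) ⊑ wordOf α)
lemma5 [] = detected⇒squareOrForbidden (from-yes (detected? (wordOf [])))
lemma5 (a ∷ []) = detected⇒squareOrForbidden
  (from-yes (all? λ a → detected? (wordOf (a ∷ []))) a)
lemma5 (a ∷ b ∷ []) = detected⇒squareOrForbidden
  (from-yes (all? λ a → all? λ b → detected? (wordOf (a ∷ b ∷ []))) a b)
lemma5 α@(a ∷ b ∷ c ∷ β) with γ , x , y , z , α≡γxyz ← lastThree a b c β =
  [ inWindow (prefixWindow-⊑ (a ∷ b ∷ c ∷ []) β refl)
  , [ inWindow (middleWindow-⊑ γ (x ∷ y ∷ z ∷ []) (a ∷ b ∷ c ∷ []) β α≡γxyz refl)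
    , inWindow (suffixWindow-⊑ γ (x ∷ y ∷ z ∷ []) α≡γxyz) ]′ ]′
  (windowsDetected a b c x y z)
  where
  inWindow : ∀ {u} → u ⊑ wordOf α → Detected u → SquareOrForbidden (wordOf α)
  inWindow u⊑w = squareOrForbidden-⊑ u⊑w ∘ detected⇒squareOrForbidden
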